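{- Let $\mathcal{C}$ be an $(m,n,2)$-scheme, $X,Y\in\mathrm{Fib}(\mathcal{C})$, and $R\in\mathcal{R}_{X,Y}$. Then $d_R(d_R-1)=\lambda(m-1)$ for some $\lambda\in\mathbb{N}$.
   Context: A scheme is a pair $\mathcal{C}=(V,\mathcal{R})$, $V$ finite, $\mathcal{R}$ a partition of $V\times V$ into nonempty relations such that $\Delta_V$ is a union of members of $\mathcal{R}$, $\mathcal{R}$ is closed under transposition, and for $R,S,T\in\mathcal{R}$ the number of $w$ with $(u,w)\in R,(w,v)\in S$ is the same for all $(u,v)\in T$. A fiber is a nonempty $X\subseteq V$ with $\Delta_X\in\mathcal{R}$; $\mathcal{R}_{X,Y}=\{R\in\mathcal{R}:R\subseteq X\times Y\}$. An $(m,n,r)$-scheme is one with $|\mathcal{R}_{X,Y}|=r$ for all fibers $X,Y$, $|X|=m$ for every fiber, and $n$ fibers. For $R\in\mathcal{R}_{X,Y}$, $d_R=|\{y:(x,y)\in R\}|$ for any $x\in X$. -}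

module Defs where

open import Data.Nat using (ℕ; zero; suc; _+_)
open import Data.Bool using (Bool; true; false; _∧_; _∨_; not; if_then_else_)
open import Data.Fin using (Fin; zero; suc; _≟_)
open import Data.Product using (Σ; ∃; ∃₂; _×_; _,_)
open import Relation.Nullary.Decidable using (⌊_⌋)
open import Relation.Binary.PropositionalEquality using (_≡_)
open import Function.Bundles using (_⇔_)

countF : ∀ {n} → (Fin n → Bool) → ℕ
countF {zero}  p = 0
countF {suc n} p = (if p zero then 1 else 0) + countF (λ i → p (suc i))

allF : ∀ {n} → (Fin n → Bool) → Bool
allF {zero}  p = true
allF {suc n} p = p zero ∧ allF (λ i → p (suc i))

anyF : ∀ {n} → (Fin n → Bool) → Bool
anyF {zero}  p = false
anyF {suc n} p = p zero ∨ anyF (λ i → p (suc i))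

_==_ : ∀ {n} → Fin n → Fin n → Bool
a == b = ⌊ a ≟ b ⌋

-- A scheme on V = Fin N whose set of basis relations is indexed by Fin k:
-- the relation with index r is { (u,v) | col u v ≡ r }.  Since col is a
-- function, the relations partition V × V.
record Scheme : Set where
  field
    N   : ℕ
    k   : ℕ
    col : Fin N → Fin N → Fin k
    nonempty : ∀ (r : Fin k) → ∃₂ λ u v → col u v ≡ r
    -- Δ_V is a union of relations: a relation meeting the diagonal lies in it
    diagUnion : ∀ (u v w : Fin N) → col v w ≡ col u u → v ≡ w
    transposeClosed : ∀ (r : Fin k) → ∃ λ (s : Fin k) →
      ∀ (u v : Fin N) → (col u v ≡ r) ⇔ (col v u ≡ s)
    intersection : ∀ (r s t : Fin k) (u v u′ v′ : Fin N) →
      col u v ≡ t → col u′ v′ ≡ t →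
      countF (λ w → col u w == r ∧ col w v == s)
        ≡ countF (λ w → col u′ w == r ∧ col w v′ == s)

module _ (C : Scheme) where
  open Scheme C

  -- fibers correspond to relations i with Δ_X = R_i, i.e. i is the colour
  -- of some diagonal pair; the fiber is X_i = { u | col u u ≡ i }
  IsFiber : Fin k → Set
  IsFiber i = ∃ λ (u : Fin N) → col u u ≡ i

  isFiberB : Fin k → Bool
  isFiberB i = anyF (λ u → col u u == i)

  InFiber : Fin k → Fin N → Set
  InFiber i u = col u u ≡ i

  Sub : Fin k → Fin k → Fin k → Set
  Sub r i j = ∀ (u v : Fin N) → col u v ≡ r → col u u ≡ i × col v v ≡ j

  subB : Fin k → Fin k → Fin k → Bool
  subB r i j = allF (λ u → allF (λ v →
                 not (col u v == r) ∨ (col u u == i ∧ col v v == j)))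

  fiberSize : Fin k → ℕ
  fiberSize i = countF (λ u → col u u == i)

  numRel : Fin k → Fin k → ℕ
  numRel i j = countF (λ r → subB r i j)

  numFibers : ℕ
  numFibers = countF isFiberB

  IsMNR : ℕ → ℕ → ℕ → Set
  IsMNR m n r =
      (∀ i j → IsFiber i → IsFiber j → numRel i j ≡ r)
    × (∀ i → IsFiber i → fiberSize i ≡ m)
    × (numFibers ≡ n)

  -- d_R computed at the point x: |{ y | (x,y) ∈ R_r }|
  deg : Fin N → Fin k → ℕ
  deg x r = countF (λ y → col x y == r)

module Submission where

-- Let R ⊆ X × Y be a basis relation of an (m,n,2)-scheme, x ∈ X, and write
-- d = d_R.  Count the R·Rᵀ-paths x → w → v (with (x,w) ∈ R, (w,v) ∈ Rᵀ) in
-- two ways.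
--   * By the midpoint w: there are d midpoints, each in Y, and each has
--     d_{Rᵀ} continuations; so there are d · d_{Rᵀ} paths.
--   * By the endpoint v: v lies in X; v = x gives d paths; since R_{X,X}
--     consists of only two relations, Δ_X and some T, every v ∈ X ∖ {x} has
--     (x,v) ∈ T and hence gives the intersection number λ = p^T_{R Rᵀ};
--     so there are d + (m - 1) λ paths.
-- Counting R from both sides gives m · d_R = m · d_{Rᵀ}, so d_{Rᵀ} = d and
-- d · d = d + (m - 1) λ, i.e. d (d - 1) = λ (m - 1).

open import Defs
open import Data.Nat using (ℕ; zero; suc; pred; _+_; _*_; _∸_)
open import Data.Nat.Properties
  using (+-*-semiring; +-identityʳ; *-identityʳ; *-comm; *-cancelˡ-≡; *-distribˡ-∸; m+n∸m≡n)
open import Data.Bool using (Bool; true; false; _∧_; _∨_; not; if_then_else_)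
open import Data.Bool.Properties using (∧-conicalˡ; ∧-conicalʳ; ∧-identityʳ; ∧-zeroʳ; ∧-idem)
open import Data.Fin using (Fin; zero; suc; _≟_)
open import Data.Fin.Properties using (suc-injective)
open import Data.Product using (∃; _×_; _,_; proj₁; proj₂; swap)
open import Data.Sum using (_⊎_; inj₁; inj₂)
open import Data.Empty using (⊥-elim)
open import Relation.Nullary using (¬_; yes; no)
open import Relation.Binary.PropositionalEquality
open import Function.Bundles using (_⇔_; Equivalence; mk⇔)
open import Algebra.Properties.Semiring.Sum +-*-semiring
  using (sum-syntax; sum-cong-≗; sum-replicate-zero; ∑-comm; ∑-distrib-+; *-distribʳ-sum)

==-true : ∀ {n} {a b : Fin n} → a ≡ b → (a == b) ≡ true
==-true {a = a} {b} a≡b with a ≟ b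
... | yes _  = refl
... | no a≢b = ⊥-elim (a≢b a≡b)

==-false : ∀ {n} {a b : Fin n} → ¬ a ≡ b → (a == b) ≡ false
==-false {a = a} {b} a≢b with a ≟ b
... | yes a≡b = ⊥-elim (a≢b a≡b)
... | no _    = refl

==-sound : ∀ {n} {a b : Fin n} → (a == b) ≡ true → a ≡ b
==-sound {a = a} {b} with a ≟ b
... | yes a≡b = λ _ → a≡b
... | no _    = λ ()

==-sound-false : ∀ {n} {a b : Fin n} → (a == b) ≡ false → ¬ a ≡ b
==-sound-false h a≡b with trans (sym h) (==-true a≡b)
... | ()

==-distinct : ∀ {n} {a b : Fin n} → not (a == b) ≡ true → ¬ a ≡ b
==-distinct h a≡b with trans (sym (cong not (==-true a≡b))) h
... | ()

==-iff : ∀ {m n} {a b : Fin m} {c d : Fin n} → (a ≡ b) ⇔ (c ≡ d) → (a == b) ≡ (c == d)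
==-iff {a = a} {b} a≡b⇔c≡d with a ≟ b
... | yes a≡b = sym (==-true (Equivalence.to a≡b⇔c≡d a≡b))
... | no a≢b  = sym (==-false (λ c≡d → a≢b (Equivalence.from a≡b⇔c≡d c≡d)))

==-suc : ∀ {n} (u a : Fin n) → (suc u == suc a) ≡ (u == a)
==-suc u a = ==-iff (mk⇔ suc-injective (cong suc))

ind : Bool → ℕ
ind b = if b then 1 else 0

punctured : ∀ {n} → (Fin n → Bool) → Fin n → Fin n → Bool
punctured p a u = p u ∧ not (u == a)

-- countF is the sum of indicators, which makes the summation library available
count-as-sum : ∀ {n} (p : Fin n → Bool) → countF p ≡ ∑[ u < n ] ind (p u)
count-as-sum {zero}  p = refl
count-as-sum {suc n} p = cong (ind (p zero) +_) (count-as-sum (λ u → p (suc u)))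

count-cong : ∀ {n} {p q : Fin n → Bool} → (∀ u → p u ≡ q u) → countF p ≡ countF q
count-cong {p = p} {q} p≗q = begin
  countF p              ≡⟨ count-as-sum p ⟩
  ∑[ u < _ ] ind (p u)  ≡⟨ sum-cong-≗ (λ u → cong ind (p≗q u)) ⟩
  ∑[ u < _ ] ind (q u)  ≡⟨ count-as-sum q ⟨
  countF q              ∎
  where open ≡-Reasoning

all-true : ∀ {n} (p : Fin n → Bool) → (∀ u → p u ≡ true) → allF p ≡ true
all-true {zero}  p h = refl
all-true {suc n} p h rewrite h zero = all-true (λ u → p (suc u)) (λ u → h (suc u))

count-none : ∀ {n} (p : Fin n → Bool) → (∀ u → p u ≡ false) → countF p ≡ 0
count-none {zero}  p none = refl
count-none {suc n} p none rewrite none zero = count-none (λ u → p (suc u)) (λ u → none (suc u))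

count-fubini : ∀ {m n} (p : Fin m → Fin n → Bool) →
  ∑[ u < m ] countF (p u) ≡ ∑[ v < n ] countF (λ u → p u v)
count-fubini {m} {n} p = begin
  ∑[ u < m ] countF (p u)                       ≡⟨ sum-cong-≗ (λ u → count-as-sum (p u)) ⟩
  ∑[ u < m ] ∑[ v < n ] ind (p u v)             ≡⟨ ∑-comm (λ u v → ind (p u v)) ⟩
  ∑[ v < n ] ∑[ u < m ] ind (p u v)             ≡⟨ sum-cong-≗ (λ v → count-as-sum (λ u → p u v)) ⟨
  ∑[ v < n ] countF (λ u → p u v)               ∎
  where open ≡-Reasoning

sum-supported-const : ∀ {n} (p : Fin n → Bool) (f : Fin n → ℕ) c →
  (∀ u → p u ≡ false → f u ≡ 0) → (∀ u → p u ≡ true → f u ≡ c) →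
  ∑[ u < n ] f u ≡ countF p * c
sum-supported-const {n} p f c off on = begin
  ∑[ u < n ] f u              ≡⟨ sum-cong-≗ indicator-form ⟩
  ∑[ u < n ] (ind (p u) * c)  ≡⟨ *-distribʳ-sum c (λ u → ind (p u)) ⟨
  (∑[ u < n ] ind (p u)) * c  ≡⟨ cong (_* c) (count-as-sum p) ⟨
  countF p * c                ∎
  where
  open ≡-Reasoning
  indicator-form : ∀ u → f u ≡ ind (p u) * c
  indicator-form u with p u in pu
  ... | true  = trans (on u pu) (sym (+-identityʳ c))
  ... | false = off u pu

sum-point : ∀ {n} (a : Fin n) x → ∑[ u < n ] (if u == a then x else 0) ≡ x
sum-point {suc n} zero    x = trans (cong (x +_) (sum-replicate-zero n)) (+-identityʳ x)
sum-point {suc n} (suc a) x = trans (sum-cong-≗ shift) (sum-point a x)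
  where
  shift : ∀ u → (if suc u == suc a then x else 0) ≡ (if u == a then x else 0)
  shift u = cong (if_then x else 0) (==-suc u a)

sum-punctured : ∀ {n} (p : Fin n → Bool) (a : Fin n) (f : Fin n → ℕ) c →
  (∀ u → p u ≡ false → f u ≡ 0) → (∀ u → punctured p a u ≡ true → f u ≡ c) →
  ∑[ u < n ] f u ≡ f a + countF (punctured p a) * c
sum-punctured {n} p a f c off on = begin
  ∑[ u < n ] f u                                        ≡⟨ sum-cong-≗ split ⟩
  ∑[ u < n ] ((if u == a then f a else 0) + rest u)     ≡⟨ ∑-distrib-+ _ rest ⟩
  ∑[ u < n ] (if u == a then f a else 0) + ∑[ u < n ] rest u
                                                        ≡⟨ cong₂ _+_ (sum-point a (f a))
                                                             (sum-supported-const (punctured p a) rest c rest-off rest-on) ⟩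
  f a + countF (punctured p a) * c                      ∎
  where
  open ≡-Reasoning
  rest : Fin n → ℕ
  rest u = if u == a then 0 else f u
  split : ∀ u → f u ≡ (if u == a then f a else 0) + rest u
  split u with u ≟ a
  ... | yes refl = sym (+-identityʳ (f u))
  ... | no _     = refl
  rest-off : ∀ u → punctured p a u ≡ false → rest u ≡ 0
  rest-off u h with u ≟ a
  ... | yes _   = refl
  ... | no _    = off u (trans (sym (∧-identityʳ (p u))) h)
  rest-on : ∀ u → punctured p a u ≡ true → rest u ≡ c
  rest-on u h = rest-apart u h (on u h)
    where
    rest-apart : ∀ u → punctured p a u ≡ true → f u ≡ c → rest u ≡ c
    rest-apart u h fu≡c with u ≟ a
    ... | no _ = fu≡c
    ... | yes _ with trans (sym (∧-zeroʳ (p u))) h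
    ...   | ()

count-remove : ∀ {n} (p : Fin n → Bool) (a : Fin n) → p a ≡ true →
  countF p ≡ suc (countF (punctured p a))
count-remove p a pa = begin
  countF p                                   ≡⟨ count-as-sum p ⟩
  ∑[ u < _ ] ind (p u)                       ≡⟨ sum-punctured p a (λ u → ind (p u)) 1 off on ⟩
  ind (p a) + countF (punctured p a) * 1     ≡⟨ cong₂ _+_ (cong ind pa) (*-identityʳ _) ⟩
  suc (countF (punctured p a))               ∎
  where
  open ≡-Reasoning
  off : ∀ u → p u ≡ false → ind (p u) ≡ 0
  off u pu = cong ind pu
  on : ∀ u → punctured p a u ≡ true → ind (p u) ≡ 1
  on u h = cong ind (∧-conicalˡ _ _ h)

count-witness : ∀ {n} (p : Fin n → Bool) {c} → countF p ≡ suc c → ∃ λ a → p a ≡ true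
count-witness {zero}  p ()
count-witness {suc n} p e with p zero in p0
... | true  = zero , p0
... | false = let (a , pa) = count-witness (λ u → p (suc u)) e in suc a , pa

count-pair : ∀ {n} (p : Fin n → Bool) {a b c} → countF p ≡ 2 →
  p a ≡ true → p b ≡ true → ¬ a ≡ b → p c ≡ true → c ≡ a ⊎ c ≡ b
count-pair p {a} {b} {c} two pa pb a≢b pc with c ≟ a | c ≟ b
... | yes c≡a | _       = inj₁ c≡a
... | no _    | yes c≡b = inj₂ c≡b
... | no c≢a  | no c≢b  with trans (sym two) (trans (count-remove p a pa)
                              (cong suc (trans (count-remove (punctured p a) b pb′)
                              (cong suc (count-remove (punctured (punctured p a) b) c pc′)))))
  where
  pb′ : punctured p a b ≡ true
  pb′ rewrite pb | ==-false (λ b≡a → a≢b (sym b≡a)) = refl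
  pc′ : punctured (punctured p a) b c ≡ true
  pc′ rewrite pc | ==-false c≢a | ==-false c≢b = refl
... | ()

module SchemeFacts (C : Scheme) where
  open Scheme C

  fiber? : Fin k → Fin N → Bool
  fiber? i u = col u u == i

  fiberSize-punctured : ∀ {i x} → InFiber C i x → fiberSize C i ≡ suc (countF (punctured (fiber? i) x))
  fiberSize-punctured {i} {x} x∈X = count-remove (fiber? i) x (==-true x∈X)

  paths : Fin k → Fin k → Fin N → Fin N → ℕ
  paths r s u v = countF (λ w → col u w == r ∧ col w v == s)

  paths-invariant : ∀ r s {u v u′ v′} → col u v ≡ col u′ v′ → paths r s u v ≡ paths r s u′ v′
  paths-invariant r s {u} {v} e = intersection r s (col u v) u v _ _ refl (sym e)

  path-transfer : ∀ {u v u′ v′ w} → col u v ≡ col u′ v′ →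
    ∃ λ w′ → col u′ w′ ≡ col u w × col w′ v′ ≡ col w v
  path-transfer {u} {v} {w = w} e
    with count-witness _ (trans (sym (paths-invariant (col u w) (col w v) e)) through-w)
    where
    through-w : paths (col u w) (col w v) u v
                  ≡ suc (countF (punctured (λ w′ → col u w′ == col u w ∧ col w′ v == col w v) w))
    through-w = count-remove _ w (cong₂ _∧_ (==-true {a = col u w} refl) (==-true {a = col w v} refl))
  ... | w′ , h = w′ , ==-sound (∧-conicalˡ _ _ h) , ==-sound (∧-conicalʳ _ _ h)

  colour-sub : ∀ u v → Sub C (col u v) (col u u) (col v v)
  colour-sub u v u′ v′ e = start , end
    where
    start : col u′ u′ ≡ col u u
    start with path-transfer {w = u} (sym e)
    ... | w′ , u′w′ , _ with diagUnion u u′ w′ u′w′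
    ... | refl = u′w′
    end : col v′ v′ ≡ col v v
    end with path-transfer {w = v} (sym e)
    ... | w′ , _ , w′v′ with diagUnion v w′ v′ w′v′
    ... | refl = w′v′

  sub-reflect : ∀ {r i j} → Sub C r i j → subB C r i j ≡ true
  sub-reflect {r} {i} {j} sub = all-true _ λ u → all-true _ λ v → cell u v
    where
    cell : ∀ u v → (not (col u v == r) ∨ (col u u == i ∧ col v v == j)) ≡ true
    cell u v with col u v ≟ r
    ... | no _   = refl
    ... | yes uv rewrite ==-true (proj₁ (sub u v uv)) | ==-true (proj₂ (sub u v uv)) = refl

  infix 30 _ᵀ
  _ᵀ : Fin k → Fin k
  r ᵀ = proj₁ (transposeClosed r)

  transpose-test : ∀ r u v → (col u v == r) ≡ (col v u == r ᵀ)
  transpose-test r u v = ==-iff (proj₂ (transposeClosed r) u v)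

  sub-transpose : ∀ {r i j} → Sub C r i j → Sub C (r ᵀ) j i
  sub-transpose {r} sub u v e = swap (sub v u (Equivalence.from (proj₂ (transposeClosed r) v u) e))

  deg-as-paths : ∀ r u → deg C u r ≡ paths r (r ᵀ) u u
  deg-as-paths r u = count-cong λ w →
    trans (sym (∧-idem _)) (cong ((col u w == r) ∧_) (transpose-test r u w))

  deg-on-fiber : ∀ r {u u′} → col u u ≡ col u′ u′ → deg C u r ≡ deg C u′ r
  deg-on-fiber r {u} {u′} e = begin
    deg C u r                  ≡⟨ deg-as-paths r u ⟩
    paths r (r ᵀ) u u          ≡⟨ paths-invariant r (r ᵀ) e ⟩
    paths r (r ᵀ) u′ u′        ≡⟨ deg-as-paths r u′ ⟨
    deg C u′ r                 ∎
    where open ≡-Reasoning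

  sum-deg : ∀ {r i j x} → Sub C r i j → InFiber C i x →
    ∑[ u < N ] deg C u r ≡ fiberSize C i * deg C x r
  sum-deg {r} {i} {x = x} sub x∈X =
    sum-supported-const (fiber? i) (λ u → deg C u r) (deg C x r) off on
    where
    off : ∀ u → fiber? i u ≡ false → deg C u r ≡ 0
    off u h = count-none _ λ v → ==-false λ uv → ==-sound-false h (proj₁ (sub u v uv))
    on : ∀ u → fiber? i u ≡ true → deg C u r ≡ deg C x r
    on u h = deg-on-fiber r (trans (==-sound h) (sym x∈X))

  sum-deg-transpose : ∀ r → ∑[ u < N ] deg C u r ≡ ∑[ v < N ] deg C v (r ᵀ)
  sum-deg-transpose r = trans (count-fubini (λ u v → col u v == r))
    (sum-cong-≗ λ v → count-cong λ u → transpose-test r u v)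

  deg-transpose : ∀ {r i j x y} → Sub C r i j → InFiber C i x → InFiber C j y →
    fiberSize C i ≡ fiberSize C j → deg C x r ≡ deg C y (r ᵀ)
  deg-transpose {r} {i} {j} {x} {y} sub x∈X y∈Y |X|≡|Y| =
    *-cancelˡ-≡ _ _ (suc |X∖x|) (subst (λ z → z * deg C x r ≡ z * deg C y (r ᵀ)) (fiberSize-punctured x∈X) (begin
      fiberSize C i * deg C x r       ≡⟨ sum-deg sub x∈X ⟨
      ∑[ u < N ] deg C u r            ≡⟨ sum-deg-transpose r ⟩
      ∑[ v < N ] deg C v (r ᵀ)        ≡⟨ sum-deg (sub-transpose sub) y∈Y ⟩
      fiberSize C j * deg C y (r ᵀ)   ≡⟨ cong (_* deg C y (r ᵀ)) |X|≡|Y| ⟨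
      fiberSize C i * deg C y (r ᵀ)   ∎))
    where
    open ≡-Reasoning
    |X∖x| : ℕ
    |X∖x| = countF (punctured (fiber? i) x)

  OffDiagonal : Fin k → Fin k → Set
  OffDiagonal i t = ∀ u v → InFiber C i u → InFiber C i v → ¬ u ≡ v → col u v ≡ t

  off-diagonal-colour : ∀ {i x} → InFiber C i x → numRel C i i ≡ 2 → ∃ (OffDiagonal i)
  off-diagonal-colour {i} {x} x∈X two = t , uniform
    where
    inXX : Fin k → Bool
    inXX r = subB C r i i
    diagonal : inXX i ≡ true
    diagonal = sub-reflect λ u v uv → let u≡v = diagUnion x u v (trans uv (sym x∈X))
      in subst (λ w → col u w ≡ i) (sym u≡v) uv , subst (λ w → col w v ≡ i) u≡v uv
    other : ∃ λ t → punctured inXX i t ≡ true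
    other = count-witness _ (cong pred (trans (sym (count-remove inXX i diagonal)) two))
    t : Fin k
    t = proj₁ other
    t-other : punctured inXX i t ≡ true
    t-other = proj₂ other
    uniform : OffDiagonal i t
    uniform u v u∈X v∈X u≢v with count-pair inXX two diagonal (∧-conicalˡ _ _ t-other)
                                    (λ i≡t → ==-distinct (∧-conicalʳ _ _ t-other) (sym i≡t))
                                    (sub-reflect (subst₂ (Sub C (col u v)) u∈X v∈X (colour-sub u v)))
    ... | inj₁ uv≡i = ⊥-elim (u≢v (diagUnion u u v (trans uv≡i (sym u∈X))))
    ... | inj₂ uv≡t = uv≡t

  paths-by-endpoint : ∀ {r i j t x u₀ v₀} → Sub C r i j → InFiber C i x →
    OffDiagonal i t → col u₀ v₀ ≡ t →
    ∑[ v < N ] paths r (r ᵀ) x v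
      ≡ deg C x r + countF (punctured (fiber? i) x) * paths r (r ᵀ) u₀ v₀
  paths-by-endpoint {r} {i} {x = x} {u₀} {v₀} sub x∈X uniform t₀ =
    trans (sum-punctured (fiber? i) x (paths r (r ᵀ) x) (paths r (r ᵀ) u₀ v₀) off on)
          (cong (_+ countF (punctured (fiber? i) x) * paths r (r ᵀ) u₀ v₀)
                (sym (deg-as-paths r x)))
    where
    off : ∀ v → (col v v == i) ≡ false → paths r (r ᵀ) x v ≡ 0
    off v h = count-none _ λ w → trans (cong ((col x w == r) ∧_)
      (==-false λ wv → ==-sound-false h (proj₂ (sub-transpose sub w v wv)))) (∧-zeroʳ _)
    on : ∀ v → punctured (fiber? i) x v ≡ true → paths r (r ᵀ) x v ≡ paths r (r ᵀ) u₀ v₀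
    on v h = paths-invariant r (r ᵀ) (trans (uniform x v x∈X (==-sound (∧-conicalˡ _ _ h))
      (λ x≡v → ==-distinct (∧-conicalʳ _ _ h) (sym x≡v))) (sym t₀))

  paths-by-midpoint : ∀ {r i j x y} → Sub C r i j → InFiber C j y →
    ∑[ v < N ] paths r (r ᵀ) x v ≡ deg C x r * deg C y (r ᵀ)
  paths-by-midpoint {r} {x = x} {y} sub y∈Y =
    trans (count-fubini (λ v w → col x w == r ∧ col w v == r ᵀ))
          (sum-supported-const (λ w → col x w == r) _ _ off on)
    where
    off : ∀ w → (col x w == r) ≡ false → countF (λ v → col x w == r ∧ col w v == r ᵀ) ≡ 0
    off w h rewrite h = count-none {N} (λ _ → false) λ _ → refl
    on : ∀ w → (col x w == r) ≡ true → countF (λ v → col x w == r ∧ col w v == r ᵀ) ≡ deg C y (r ᵀ)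
    on w h rewrite h = deg-on-fiber (r ᵀ) (trans (proj₂ (sub x w (==-sound h))) (sym y∈Y))

square-identity : ∀ d k → d * d ≡ d + k → d * (d ∸ 1) ≡ k
square-identity d k e = begin
  d * (d ∸ 1)    ≡⟨ *-distribˡ-∸ d d 1 ⟩
  d * d ∸ d * 1  ≡⟨ cong₂ _∸_ e (*-identityʳ d) ⟩
  d + k ∸ d      ≡⟨ m+n∸m≡n d k ⟩
  k              ∎
  where open ≡-Reasoning

lemma15 : (C : Scheme) (m n : ℕ) → IsMNR C m n 2 →
    (i j r : Fin (Scheme.k C)) → IsFiber C i → IsFiber C j → Sub C r i j →
    (x : Fin (Scheme.N C)) → InFiber C i x →
    ∃ λ (l : ℕ) → deg C x r * (deg C x r ∸ 1) ≡ l * (m ∸ 1)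
lemma15 C m n (rank , size , _) i j r X-fiber (y , y∈Y) sub x x∈X
  with SchemeFacts.off-diagonal-colour C x∈X (rank i i X-fiber X-fiber)
... | t , uniform with Scheme.nonempty C t
... | u₀ , v₀ , t₀ = λ′ , (begin
    d * (d ∸ 1)   ≡⟨ square-identity d (|X∖x| * λ′) two-counts ⟩
    |X∖x| * λ′    ≡⟨ *-comm |X∖x| λ′ ⟩
    λ′ * |X∖x|    ≡⟨ cong (λ z → λ′ * (z ∸ 1)) |X|≡1+|X∖x| ⟨
    λ′ * (m ∸ 1)  ∎)
  where
  open ≡-Reasoning
  open SchemeFacts C
  d : ℕ
  d = deg C x r
  λ′ : ℕ
  λ′ = paths r (r ᵀ) u₀ v₀
  |X∖x| : ℕ
  |X∖x| = countF (punctured (fiber? i) x)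
  |X|≡1+|X∖x| : m ≡ suc |X∖x|
  |X|≡1+|X∖x| = trans (sym (size i X-fiber)) (fiberSize-punctured x∈X)
  d≡dᵀ : d ≡ deg C y (r ᵀ)
  d≡dᵀ = deg-transpose sub x∈X y∈Y (trans (size i X-fiber) (sym (size j (y , y∈Y))))
  two-counts : d * d ≡ d + |X∖x| * λ′
  two-counts = begin
    d * d                         ≡⟨ cong (d *_) d≡dᵀ ⟩
    d * deg C y (r ᵀ)             ≡⟨ paths-by-midpoint sub y∈Y ⟨
    ∑[ v < _ ] paths r (r ᵀ) x v  ≡⟨ paths-by-endpoint sub x∈X uniform t₀ ⟩
    d + |X∖x| * λ′                ∎
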